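{- Let $\Sigma$ be a finite alphabet of numbers with $\sigma = |\Sigma| \ge 2$. Let $T$ be a text and $P_1,\dots,P_k$ patterns over $\Sigma$, all of whose characters are statistically independent and uniformly distributed over $\Sigma$. Let $m = \min_i |P_i|$, $M = \sum_{i=1}^k |P_i|$ and $P_i' = P_i[1..m]$. For each window $T[j..j+m-1]$ of the text, the verification step for that window consists of, for every $i$ with $\beta(T[j..j+m-1]) = \beta(P_i')$, checking whether $P_i$ order-preservingly matches the text at that window, at cost $O(|P_i|)$. Suppose $M$ is polynomial with respect to $m$ (i.e. $M = O(m^c)$ for some constant $c$). Then the expected cost of the verification step for a window is $O(1)$.
   Context: For a string $z$ of length $m$ over a totally ordered alphabet, $\beta(z)$ is the binary string of length $m-1$ with $\beta(z)[i] = 1$ if $z[i] < z[i+1]$ and $\beta(z)[i] = 0$ otherwise. For a string $z$ and character $c$, $rank_z(c) = 1 + |\{ i : z[i] < c\}|$, and $Nat(z) = (rank_z(z[1]),\dots,rank_z(z[|z|]))$; a pattern $P$ order-preservingly matches the text at position $i$ if $Nat(P) = Nat(T[i-|P|+1..i])$. The notation $z[a..c]$ denotes the substring $(z[a],\dots,z[c])$. -}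

module Defs where

open import Data.Nat using (ℕ; zero; suc; _+_; _*_; _^_; _<ᵇ_; _⊓_)
open import Data.Bool using (Bool; if_then_else_)
open import Data.Fin using (Fin; toℕ)
open import Data.List using (List; []; _∷_; map; concatMap; take; length; foldr; allFin)
open import Data.Nat.ListAction using (sum)
open import Data.List.Properties using (≡-dec)
open import Data.Bool.Properties using () renaming (_≟_ to _≟ᵇ_)
open import Relation.Nullary using (does)


-- The alphabet Σ of size σ is Fin σ, ordered by its numeric value (toℕ).

β : ∀ {σ} → List (Fin σ) → List Bool
β []             = []
β (x ∷ [])       = []
β (x ∷ y ∷ rest) = (toℕ x <ᵇ toℕ y) ∷ β (y ∷ rest)

-- All strings of length n over Fin σ (each exactly once): the uniform sample space.
allStrings : (σ : ℕ) → ℕ → List (List (Fin σ))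
allStrings σ zero    = [] ∷ []
allStrings σ (suc n) =
  concatMap (λ c → map (c ∷_) (allStrings σ n)) (allFin σ)

allPatternTuples : (σ : ℕ) → List ℕ → List (List (List (Fin σ)))
allPatternTuples σ []       = [] ∷ []
allPatternTuples σ (l ∷ ls) =
  concatMap (λ p → map (p ∷_) (allPatternTuples σ ls)) (allStrings σ l)

minLen : ℕ → List ℕ → ℕ
minLen l₀ ls = foldr _⊓_ l₀ ls

-- Verification cost for a window w (of length m) and patterns ps:
-- for every i with β(w) = β(P_i[1..m]) we pay |P_i| (the O(|P_i|) check).
verifyCost : ∀ {σ} → List (Fin σ) → List (List (Fin σ)) → ℕ
verifyCost {σ} w ps =
  sum (map (λ p → if does (≡-dec _≟ᵇ_ (β w) (β (take (length w) p)))
                  then length p else 0) ps)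

-- Sum of the verification cost over the whole (uniform, independent) sample
-- space: window w uniform in Σ^m, P_i uniform in Σ^{|P_i|}.
-- Expected cost = totalCost / σ^(m + M).
totalCost : (σ : ℕ) → (m : ℕ) → List ℕ → ℕ
totalCost σ m ls =
  sum (concatMap (λ w → map (verifyCost w) (allPatternTuples σ ls))
                 (allStrings σ m))

-- Window and pattern prefixes are independent and uniform, so by linearity the expected cost
-- is M · Pr[β(w) = β(q)] for independent uniform w, q ∈ Σ^m.  Cutting w and q into consecutive
-- letter pairs, the comparison bits of disjoint pairs are independent, and two uniform pairs
-- compare alike with probability K/σ⁴ < 1, where K counts the agreeing quadruples of letters
-- (the pairs (0,1) and (0,0) do not agree).  So
-- Pr[β(w) = β(q)] ≤ (K/σ⁴)^⌊m/2⌋, which beats the polynomial bound M = O(m^c).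
module Submission where

open import Defs
open import Data.Bool using (Bool; true; false; if_then_else_)
open import Data.Bool.Properties using () renaming (_≟_ to _≟ᵇ_)
open import Data.Fin using (Fin; toℕ) renaming (zero to fzero; suc to fsuc)
open import Data.List using (List; []; _∷_; _++_; map; concatMap; take; length; allFin)
open import Data.List.Properties using (≡-dec; ∷-injective; length-++; length-map; length-tabulate; map-id; map-++; map-∘)
open import Data.List.Membership.Propositional using (_∈_)
open import Data.List.Relation.Unary.Any using (here; there)
open import Data.List.Relation.Unary.All as All using (All; []; _∷_)
open import Data.Nat using (ℕ; zero; suc; _+_; _*_; _^_; _≤_; _<_; _<ᵇ_; z≤n; s≤s; >-nonZero)
open import Data.Nat.DivMod using (_/_; _%_; m≡m%n+[m/n]*n; m%n<n)
open import Data.Nat.ListAction using (sum)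
open import Data.Nat.ListAction.Properties using (sum-++)
open import Data.Nat.Properties
open import Data.Nat.Tactic.RingSolver using (solve-∀)
open import Data.Product using (∃; _,_; proj₂)
open import Function using (_∘_; id)
open import Relation.Binary.PropositionalEquality
open import Relation.Nullary using (does; yes; no)
open import Relation.Nullary.Decidable using (dec-true)

private variable
  A B C : Set

∑ : List A → (A → ℕ) → ℕ
∑ xs f = sum (map f xs)

∑-cong : (xs : List A) {f g : A → ℕ} → (∀ x → f x ≡ g x) → ∑ xs f ≡ ∑ xs g
∑-cong []       f≡g = refl
∑-cong (x ∷ xs) f≡g = cong₂ _+_ (f≡g x) (∑-cong xs f≡g)

∑-mono-≤ : (xs : List A) {f g : A → ℕ} → (∀ x → f x ≤ g x) → ∑ xs f ≤ ∑ xs g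
∑-mono-≤ []       f≤g = z≤n
∑-mono-≤ (x ∷ xs) f≤g = +-mono-≤ (f≤g x) (∑-mono-≤ xs f≤g)

∑-++ : (xs ys : List A) (f : A → ℕ) → ∑ (xs ++ ys) f ≡ ∑ xs f + ∑ ys f
∑-++ xs ys f = trans (cong sum (map-++ f xs ys)) (sum-++ (map f xs) (map f ys))

∑-distrib-+ : (xs : List A) (f g : A → ℕ) → ∑ xs (λ x → f x + g x) ≡ ∑ xs f + ∑ xs g
∑-distrib-+ []       f g = refl
∑-distrib-+ (x ∷ xs) f g = trans (cong (f x + g x +_) (∑-distrib-+ xs f g))
                                 (interchange (f x) (g x) (∑ xs f) (∑ xs g))
  where
  interchange : ∀ a b c d → a + b + (c + d) ≡ a + c + (b + d)
  interchange = solve-∀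

∑-*ˡ : (xs : List A) (k : ℕ) (f : A → ℕ) → ∑ xs (λ x → k * f x) ≡ k * ∑ xs f
∑-*ˡ []       k f = sym (*-zeroʳ k)
∑-*ˡ (x ∷ xs) k f = trans (cong (k * f x +_) (∑-*ˡ xs k f)) (sym (*-distribˡ-+ k (f x) (∑ xs f)))

∑-*ʳ : (xs : List A) (k : ℕ) (f : A → ℕ) → ∑ xs (λ x → f x * k) ≡ ∑ xs f * k
∑-*ʳ xs k f = trans (∑-cong xs (λ x → *-comm (f x) k)) (trans (∑-*ˡ xs k f) (*-comm k (∑ xs f)))

∑-const : (xs : List A) (k : ℕ) → ∑ xs (λ _ → k) ≡ length xs * k
∑-const []       k = refl
∑-const (x ∷ xs) k = cong (k +_) (∑-const xs k)

∑-≤-const : (xs : List A) {f : A → ℕ} {n : ℕ} → (∀ x → f x ≤ n) → ∑ xs f ≤ length xs * n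
∑-≤-const xs {n = n} f≤n = ≤-trans (∑-mono-≤ xs f≤n) (≤-reflexive (∑-const xs n))

∑-<-const : (xs : List A) {f : A → ℕ} {n : ℕ} → (∀ x → f x ≤ n) →
            ∀ {x₀} → x₀ ∈ xs → f x₀ < n → ∑ xs f < length xs * n
∑-<-const (x ∷ xs) f≤n (here refl)    fx<n  = +-mono-<-≤ fx<n (∑-≤-const xs f≤n)
∑-<-const (x ∷ xs) f≤n (there x₀∈xs) fx₀<n = +-mono-≤-< (f≤n x) (∑-<-const xs f≤n x₀∈xs fx₀<n)

∑-pairs-+ : (xs : List A) (ys : List B) (f : A → ℕ) (g : B → ℕ) →
            ∑ xs (λ x → ∑ ys (λ y → f x + g y)) ≡ length ys * ∑ xs f + length xs * ∑ ys g
∑-pairs-+ xs ys f g = begin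
    ∑ xs (λ x → ∑ ys (λ y → f x + g y))
  ≡⟨ ∑-cong xs (λ x → trans (∑-distrib-+ ys (λ _ → f x) g) (cong (_+ ∑ ys g) (∑-const ys (f x)))) ⟩
    ∑ xs (λ x → length ys * f x + ∑ ys g)
  ≡⟨ ∑-distrib-+ xs (λ x → length ys * f x) (λ _ → ∑ ys g) ⟩
    ∑ xs (λ x → length ys * f x) + ∑ xs (λ _ → ∑ ys g)
  ≡⟨ cong₂ _+_ (∑-*ˡ xs (length ys) f) (∑-const xs (∑ ys g)) ⟩
    length ys * ∑ xs f + length xs * ∑ ys g ∎
  where open ≡-Reasoning

∑-concatMap-map : (xs : List A) (ys : A → List B) (h : A → B → C) (f : C → ℕ) →
                  ∑ (concatMap (λ x → map (h x) (ys x)) xs) f ≡ ∑ xs (λ x → ∑ (ys x) (f ∘ h x))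
∑-concatMap-map []       ys h f = refl
∑-concatMap-map (x ∷ xs) ys h f = trans (∑-++ (map (h x) (ys x)) _ f)
  (cong₂ _+_ (cong sum (sym (map-∘ (ys x)))) (∑-concatMap-map xs ys h f))

sum-concatMap-map : (xs : List A) (ys : List B) (g : A → B → ℕ) →
                    sum (concatMap (λ x → map (g x) ys) xs) ≡ ∑ xs (λ x → ∑ ys (g x))
sum-concatMap-map xs ys g =
  trans (cong sum (sym (map-id (concatMap (λ x → map (g x) ys) xs)))) (∑-concatMap-map xs (λ _ → ys) g id)

length-concatMap-map : (xs : List A) (ys : List B) (h : A → B → C) →
                       length (concatMap (λ x → map (h x) ys) xs) ≡ length xs * length ys
length-concatMap-map []       ys h = refl
length-concatMap-map (x ∷ xs) ys h = trans (length-++ (map (h x) ys))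
  (cong₂ _+_ (length-map (h x) ys) (length-concatMap-map xs ys h))

^-distribʳ-* : ∀ x y n → (x * y) ^ n ≡ x ^ n * y ^ n
^-distribʳ-* x y zero    = refl
^-distribʳ-* x y (suc n) = trans (cong (x * y *_) (^-distribʳ-* x y n)) (interchange x y (x ^ n) (y ^ n))
  where
  interchange : ∀ a b c d → a * b * (c * d) ≡ a * c * (b * d)
  interchange = solve-∀

indicator : Bool → ℕ
indicator b = if b then 1 else 0

indicator≤1 : ∀ b → indicator b ≤ 1
indicator≤1 true  = ≤-refl
indicator≤1 false = z≤n

if-then-else-0≡indicator* : ∀ b n → (if b then n else 0) ≡ indicator b * n
if-then-else-0≡indicator* true  n = sym (+-identityʳ n)
if-then-else-0≡indicator* false n = refl

β-tail : ∀ {σ} {b b' : Fin σ} {w q} → β (b ∷ w) ≡ β (b' ∷ q) → β w ≡ β q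
β-tail {w = []}    {[]}    _  = refl
β-tail {w = x ∷ w} {y ∷ q} eq = proj₂ (∷-injective eq)

module _ (σ : ℕ) where

  length-allFin : length (allFin σ) ≡ σ
  length-allFin = length-tabulate id

  length-allStrings : ∀ n → length (allStrings σ n) ≡ σ ^ n
  length-allStrings zero    = refl
  length-allStrings (suc n) = trans (length-concatMap-map (allFin σ) (allStrings σ n) _∷_)
                                    (cong₂ _*_ length-allFin (length-allStrings n))

  length-allPatternTuples : ∀ ls → length (allPatternTuples σ ls) ≡ σ ^ sum ls
  length-allPatternTuples []       = refl
  length-allPatternTuples (l ∷ ls) = begin
      length (allPatternTuples σ (l ∷ ls))
    ≡⟨ length-concatMap-map (allStrings σ l) (allPatternTuples σ ls) _∷_ ⟩
      length (allStrings σ l) * length (allPatternTuples σ ls)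
    ≡⟨ cong₂ _*_ (length-allStrings l) (length-allPatternTuples ls) ⟩
      σ ^ l * σ ^ sum ls
    ≡⟨ ^-distribˡ-+-* σ l (sum ls) ⟨
      σ ^ sum (l ∷ ls) ∎
    where open ≡-Reasoning

  ∑-allStrings-suc : ∀ n (f : List (Fin σ) → ℕ) →
                     ∑ (allStrings σ (suc n)) f ≡ ∑ (allFin σ) (λ a → ∑ (allStrings σ n) (f ∘ (a ∷_)))
  ∑-allStrings-suc n f = ∑-concatMap-map (allFin σ) (λ _ → allStrings σ n) _∷_ f

  ∑-allStrings-suc-suc : ∀ n (f : List (Fin σ) → ℕ) →
    ∑ (allStrings σ (suc (suc n))) f ≡
    ∑ (allFin σ) (λ a → ∑ (allFin σ) (λ b → ∑ (allStrings σ n) (λ w → f (a ∷ b ∷ w))))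
  ∑-allStrings-suc-suc n f = trans (∑-allStrings-suc (suc n) f)
    (∑-cong (allFin σ) (λ a → ∑-allStrings-suc n (f ∘ (a ∷_))))

  ∑-allStrings-cong : ∀ n {f g : List (Fin σ) → ℕ} → (∀ w → length w ≡ n → f w ≡ g w) →
                      ∑ (allStrings σ n) f ≡ ∑ (allStrings σ n) g
  ∑-allStrings-cong zero    f≡g = cong (_+ 0) (f≡g [] refl)
  ∑-allStrings-cong (suc n) {f} {g} f≡g = begin
      ∑ (allStrings σ (suc n)) f
    ≡⟨ ∑-allStrings-suc n f ⟩
      ∑ (allFin σ) (λ a → ∑ (allStrings σ n) (f ∘ (a ∷_)))
    ≡⟨ ∑-cong (allFin σ) (λ a → ∑-allStrings-cong n (λ w ∣w∣≡n → f≡g (a ∷ w) (cong suc ∣w∣≡n))) ⟩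
      ∑ (allFin σ) (λ a → ∑ (allStrings σ n) (g ∘ (a ∷_)))
    ≡⟨ ∑-allStrings-suc n g ⟨
      ∑ (allStrings σ (suc n)) g ∎
    where open ≡-Reasoning

  ∑-allStrings-take : ∀ m d (h : List (Fin σ) → ℕ) →
                      ∑ (allStrings σ (m + d)) (h ∘ take m) ≡ σ ^ d * ∑ (allStrings σ m) h
  ∑-allStrings-take zero    d h = begin
      ∑ (allStrings σ d) (λ _ → h [])
    ≡⟨ ∑-const (allStrings σ d) (h []) ⟩
      length (allStrings σ d) * h []
    ≡⟨ cong₂ _*_ (length-allStrings d) (sym (+-identityʳ (h []))) ⟩
      σ ^ d * (h [] + 0) ∎
    where open ≡-Reasoning
  ∑-allStrings-take (suc m) d h = begin
      ∑ (allStrings σ (suc (m + d))) (h ∘ take (suc m))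
    ≡⟨ ∑-allStrings-suc (m + d) _ ⟩
      ∑ (allFin σ) (λ a → ∑ (allStrings σ (m + d)) (h ∘ (a ∷_) ∘ take m))
    ≡⟨ ∑-cong (allFin σ) (λ a → ∑-allStrings-take m d (h ∘ (a ∷_))) ⟩
      ∑ (allFin σ) (λ a → σ ^ d * ∑ (allStrings σ m) (h ∘ (a ∷_)))
    ≡⟨ ∑-*ˡ (allFin σ) (σ ^ d) _ ⟩
      σ ^ d * ∑ (allFin σ) (λ a → ∑ (allStrings σ m) (h ∘ (a ∷_)))
    ≡⟨ cong (σ ^ d *_) (∑-allStrings-suc m h) ⟨
      σ ^ d * ∑ (allStrings σ (suc m)) h ∎
    where open ≡-Reasoning

  βAgree : List (Fin σ) → List (Fin σ) → ℕ
  βAgree w q = indicator (does (≡-dec _≟ᵇ_ (β w) (β q)))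

  βMatches : ℕ → List (Fin σ) → ℕ
  βMatches m w = ∑ (allStrings σ m) (βAgree w)

  -- σ^(2m) · Pr[β(w) = β(q)] for independent uniform w, q of length m.
  βCollisions : ℕ → ℕ
  βCollisions m = ∑ (allStrings σ m) (βMatches m)

  -- Spelled exactly as the summand of verifyCost, so verifyCost w (p ∷ ps) reduces to
  -- patternCost w p + verifyCost w ps.
  patternCost : List (Fin σ) → List (Fin σ) → ℕ
  patternCost w p = if does (≡-dec _≟ᵇ_ (β w) (β (take (length w) p))) then length p else 0

  ∑-patternCost : ∀ w l → length w ≤ l →
    σ ^ length w * ∑ (allStrings σ l) (patternCost w) ≡ l * σ ^ l * βMatches (length w) w
  ∑-patternCost w l m≤l with m≤n⇒∃[o]m+o≡n m≤l
  ... | d , refl = begin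
      σ ^ m * ∑ (allStrings σ l) (patternCost w)
    ≡⟨ cong (σ ^ m *_) (∑-allStrings-cong l λ p ∣p∣≡l →
         trans (if-then-else-0≡indicator* _ (length p)) (cong (βAgree w (take m p) *_) ∣p∣≡l)) ⟩
      σ ^ m * ∑ (allStrings σ l) (λ p → βAgree w (take m p) * l)
    ≡⟨ cong (σ ^ m *_) (∑-*ʳ (allStrings σ l) l (βAgree w ∘ take m)) ⟩
      σ ^ m * (∑ (allStrings σ (m + d)) (βAgree w ∘ take m) * l)
    ≡⟨ cong (λ n → σ ^ m * (n * l)) (∑-allStrings-take m d (βAgree w)) ⟩
      σ ^ m * (σ ^ d * βMatches m w * l)
    ≡⟨ reassoc (σ ^ m) (σ ^ d) (βMatches m w) l ⟩
      l * (σ ^ m * σ ^ d) * βMatches m w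
    ≡⟨ cong (λ n → l * n * βMatches m w) (^-distribˡ-+-* σ m d) ⟨
      l * σ ^ l * βMatches m w ∎
    where
    open ≡-Reasoning
    m = length w
    reassoc : ∀ a b c n → a * (b * c * n) ≡ n * (a * b) * c
    reassoc = solve-∀

  ∑-verifyCost : ∀ w ls → All (length w ≤_) ls →
    σ ^ length w * ∑ (allPatternTuples σ ls) (verifyCost w) ≡ sum ls * σ ^ sum ls * βMatches (length w) w
  ∑-verifyCost w []       []             = *-zeroʳ (σ ^ length w)
  ∑-verifyCost w (l ∷ ls) (m≤l ∷ m≤ls) = begin
      σ ^ m * ∑ (allPatternTuples σ (l ∷ ls)) (verifyCost w)
    ≡⟨ cong (σ ^ m *_) (∑-concatMap-map (allStrings σ l) (λ _ → Ts) _∷_ (verifyCost w)) ⟩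
      σ ^ m * ∑ (allStrings σ l) (λ p → ∑ Ts (λ ps → patternCost w p + verifyCost w ps))
    ≡⟨ cong (σ ^ m *_) (∑-pairs-+ (allStrings σ l) Ts (patternCost w) (verifyCost w)) ⟩
      σ ^ m * (length Ts * P + length (allStrings σ l) * V)
    ≡⟨ cong (σ ^ m *_) (cong₂ _+_ (cong (_* P) (length-allPatternTuples ls)) (cong (_* V) (length-allStrings l))) ⟩
      σ ^ m * (σ ^ L * P + σ ^ l * V)
    ≡⟨ distrib (σ ^ m) (σ ^ L) P (σ ^ l) V ⟩
      σ ^ L * (σ ^ m * P) + σ ^ l * (σ ^ m * V)
    ≡⟨ cong₂ _+_ (cong (σ ^ L *_) (∑-patternCost w l m≤l)) (cong (σ ^ l *_) (∑-verifyCost w ls m≤ls)) ⟩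
      σ ^ L * (l * σ ^ l * c) + σ ^ l * (L * σ ^ L * c)
    ≡⟨ collect (σ ^ L) l (σ ^ l) c L ⟩
      (l + L) * (σ ^ l * σ ^ L) * c
    ≡⟨ cong (λ n → (l + L) * n * c) (^-distribˡ-+-* σ l L) ⟨
      sum (l ∷ ls) * σ ^ sum (l ∷ ls) * c ∎
    where
    open ≡-Reasoning
    m = length w
    L = sum ls
    c = βMatches m w
    Ts = allPatternTuples σ ls
    P = ∑ (allStrings σ l) (patternCost w)
    V = ∑ Ts (verifyCost w)
    distrib : ∀ a x p y v → a * (x * p + y * v) ≡ x * (a * p) + y * (a * v)
    distrib = solve-∀
    collect : ∀ x l y c L → x * (l * y * c) + y * (L * x * c) ≡ (l + L) * (y * x) * c
    collect = solve-∀

  totalCost-identity : ∀ m ls → All (m ≤_) ls →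
                       σ ^ m * totalCost σ m ls ≡ sum ls * σ ^ sum ls * βCollisions m
  totalCost-identity m ls m≤ls = begin
      σ ^ m * totalCost σ m ls
    ≡⟨ cong (σ ^ m *_) (sum-concatMap-map (allStrings σ m) (allPatternTuples σ ls) verifyCost) ⟩
      σ ^ m * ∑ (allStrings σ m) (λ w → ∑ (allPatternTuples σ ls) (verifyCost w))
    ≡⟨ ∑-*ˡ (allStrings σ m) (σ ^ m) _ ⟨
      ∑ (allStrings σ m) (λ w → σ ^ m * ∑ (allPatternTuples σ ls) (verifyCost w))
    ≡⟨ ∑-allStrings-cong m (λ { w refl → ∑-verifyCost w ls m≤ls }) ⟩
      ∑ (allStrings σ m) (λ w → sum ls * σ ^ sum ls * βMatches m w)
    ≡⟨ ∑-*ˡ (allStrings σ m) (sum ls * σ ^ sum ls) (βMatches m) ⟩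
      sum ls * σ ^ sum ls * βCollisions m ∎
    where open ≡-Reasoning

  βAgree-≡-1 : ∀ {w q} → β w ≡ β q → βAgree w q ≡ 1
  βAgree-≡-1 {w} {q} βw≡βq = cong indicator (dec-true (≡-dec _≟ᵇ_ (β w) (β q)) βw≡βq)

  sameOrder : Fin σ → Fin σ → Fin σ → Fin σ → ℕ
  sameOrder a b a' b' = indicator (does ((toℕ a <ᵇ toℕ b) ≟ᵇ (toℕ a' <ᵇ toℕ b')))

  pairAgreements : Fin σ → Fin σ → ℕ
  pairAgreements a b = ∑ (allFin σ) (λ a' → ∑ (allFin σ) (sameOrder a b a'))

  orderAgreements : ℕ
  orderAgreements = ∑ (allFin σ) (λ a → ∑ (allFin σ) (pairAgreements a))

  -- Forgetting the comparison of b with the head of w is what makes the letter pairs independent.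
  βAgree-∷∷ : ∀ a b w a' b' q → βAgree (a ∷ b ∷ w) (a' ∷ b' ∷ q) ≤ sameOrder a b a' b' * βAgree w q
  βAgree-∷∷ a b w a' b' q
    with (toℕ a <ᵇ toℕ b) ≟ᵇ (toℕ a' <ᵇ toℕ b') | ≡-dec _≟ᵇ_ (β (b ∷ w)) (β (b' ∷ q))
  ... | no _  | _       = z≤n
  ... | yes _ | no _    = z≤n
  ... | yes _ | yes eq = ≤-reflexive (sym (trans (+-identityʳ _) (βAgree-≡-1 (β-tail eq))))

  βMatches-∷∷ : ∀ m a b w → βMatches (suc (suc m)) (a ∷ b ∷ w) ≤ pairAgreements a b * βMatches m w
  βMatches-∷∷ m a b w = begin
      βMatches (suc (suc m)) (a ∷ b ∷ w)
    ≡⟨ ∑-allStrings-suc-suc m _ ⟩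
      ∑ F (λ a' → ∑ F (λ b' → ∑ (allStrings σ m) (λ q → βAgree (a ∷ b ∷ w) (a' ∷ b' ∷ q))))
    ≤⟨ ∑-mono-≤ F (λ a' → ∑-mono-≤ F (λ b' → ∑-mono-≤ (allStrings σ m) (βAgree-∷∷ a b w a' b'))) ⟩
      ∑ F (λ a' → ∑ F (λ b' → ∑ (allStrings σ m) (λ q → sameOrder a b a' b' * βAgree w q)))
    ≡⟨ ∑-cong F (λ a' → ∑-cong F (λ b' → ∑-*ˡ (allStrings σ m) (sameOrder a b a' b') (βAgree w))) ⟩
      ∑ F (λ a' → ∑ F (λ b' → sameOrder a b a' b' * βMatches m w))
    ≡⟨ ∑-cong F (λ a' → ∑-*ʳ F (βMatches m w) (sameOrder a b a')) ⟩
      ∑ F (λ a' → ∑ F (sameOrder a b a') * βMatches m w)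
    ≡⟨ ∑-*ʳ F (βMatches m w) _ ⟩
      pairAgreements a b * βMatches m w ∎
    where
    open ≤-Reasoning
    F = allFin σ

  βCollisions-suc-suc : ∀ m → βCollisions (suc (suc m)) ≤ orderAgreements * βCollisions m
  βCollisions-suc-suc m = begin
      βCollisions (suc (suc m))
    ≡⟨ ∑-allStrings-suc-suc m _ ⟩
      ∑ F (λ a → ∑ F (λ b → ∑ (allStrings σ m) (λ w → βMatches (suc (suc m)) (a ∷ b ∷ w))))
    ≤⟨ ∑-mono-≤ F (λ a → ∑-mono-≤ F (λ b → ∑-mono-≤ (allStrings σ m) (βMatches-∷∷ m a b))) ⟩
      ∑ F (λ a → ∑ F (λ b → ∑ (allStrings σ m) (λ w → pairAgreements a b * βMatches m w)))
    ≡⟨ ∑-cong F (λ a → ∑-cong F (λ b → ∑-*ˡ (allStrings σ m) (pairAgreements a b) (βMatches m))) ⟩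
      ∑ F (λ a → ∑ F (λ b → pairAgreements a b * βCollisions m))
    ≡⟨ ∑-cong F (λ a → ∑-*ʳ F (βCollisions m) (pairAgreements a)) ⟩
      ∑ F (λ a → ∑ F (pairAgreements a) * βCollisions m)
    ≡⟨ ∑-*ʳ F (βCollisions m) _ ⟩
      orderAgreements * βCollisions m ∎
    where
    open ≤-Reasoning
    F = allFin σ

  βCollisions-j*2+r : ∀ j r → βCollisions (j * 2 + r) ≤ orderAgreements ^ j * βCollisions r
  βCollisions-j*2+r zero    r = ≤-reflexive (sym (+-identityʳ (βCollisions r)))
  βCollisions-j*2+r (suc j) r = begin
      βCollisions (suc (suc (j * 2 + r)))
    ≤⟨ βCollisions-suc-suc (j * 2 + r) ⟩
      orderAgreements * βCollisions (j * 2 + r)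
    ≤⟨ *-monoʳ-≤ orderAgreements (βCollisions-j*2+r j r) ⟩
      orderAgreements * (orderAgreements ^ j * βCollisions r)
    ≡⟨ *-assoc orderAgreements (orderAgreements ^ j) (βCollisions r) ⟨
      orderAgreements ^ suc j * βCollisions r ∎
    where open ≤-Reasoning

  βCollisions≤ : ∀ m → βCollisions m ≤ σ ^ m * σ ^ m
  βCollisions≤ m = begin
      βCollisions m
    ≤⟨ ∑-≤-const (allStrings σ m) (λ w → ∑-≤-const (allStrings σ m) (λ q → indicator≤1 _)) ⟩
      length (allStrings σ m) * (length (allStrings σ m) * 1)
    ≡⟨ cong₂ _*_ (length-allStrings m) (trans (*-identityʳ _) (length-allStrings m)) ⟩
      σ ^ m * σ ^ m ∎
    where open ≤-Reasoning

orderAgreements<σ⁴ : ∀ σ → 2 ≤ σ → orderAgreements σ < σ ^ 4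
orderAgreements<σ⁴ 1 (s≤s ())
orderAgreements<σ⁴ σ@(suc (suc _)) _ =
  subst (λ n → orderAgreements σ < n * (n * (n * (n * 1)))) (length-allFin σ)
    (∑-<-const F (λ a → ∑-≤-const F (pairAgreements≤ a)) (here refl)
      (∑-<-const F (pairAgreements≤ fzero) (there (here refl))
        (∑-<-const F (λ a' → ∑-≤-const F (sameOrder≤1 fzero (fsuc fzero) a')) (here refl)
          (∑-<-const F (sameOrder≤1 fzero (fsuc fzero) fzero) (here refl) (s≤s z≤n)))))
  where
  F = allFin σ
  sameOrder≤1 : ∀ a b a' b' → sameOrder σ a b a' b' ≤ 1
  sameOrder≤1 a b a' b' = indicator≤1 _
  pairAgreements≤ : ∀ a b → pairAgreements σ a b ≤ length F * (length F * 1)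
  pairAgreements≤ a b = ∑-≤-const F (λ a' → ∑-≤-const F (sameOrder≤1 a b a'))

[1+j]*x^j≤[1+x]^[1+j] : ∀ x j → suc j * x ^ j ≤ suc x ^ suc j
[1+j]*x^j≤[1+x]^[1+j] x zero    = s≤s z≤n
[1+j]*x^j≤[1+x]^[1+j] x (suc j) = begin
    suc (suc j) * x ^ suc j
  ≡⟨ split (x ^ j) x j ⟩
    x ^ suc j + x * (suc j * x ^ j)
  ≤⟨ +-mono-≤ (^-monoˡ-≤ (suc j) (n≤1+n x)) (*-monoʳ-≤ x ([1+j]*x^j≤[1+x]^[1+j] x j)) ⟩
    suc x ^ suc j + x * suc x ^ suc j ∎
  where
  open ≤-Reasoning
  split : ∀ p x j → (2 + j) * (x * p) ≡ x * p + x * ((1 + j) * p)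
  split = solve-∀

-- Induction on c: multiplying by 2^j turns the extra factor suc j · (2a)^j into at most
-- (1 + 2a)^(suc j), and 1 + 2a < 2b lets the hypothesis for c absorb the rest.
polynomial-≤-exponential : ∀ c {a b} → a < b → ∃ λ D → ∀ j → suc j ^ c * a ^ j ≤ D * b ^ j
polynomial-≤-exponential zero    a<b = 1 , λ j → +-monoˡ-≤ 0 (^-monoˡ-≤ j (<⇒≤ a<b))
polynomial-≤-exponential (suc c) {a} {b} a<b
  with polynomial-≤-exponential c {1 + 2 * a} {2 * b} (≤-trans (≤-reflexive (sym (*-suc 2 a))) (*-monoʳ-≤ 2 a<b))
... | D , dom = (1 + 2 * a) * D , λ j → *-cancelˡ-≤ (2 ^ j) {{m^n≢0 2 j}} (begin
    2 ^ j * (suc j ^ suc c * a ^ j)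
  ≡⟨ regroup (2 ^ j) (suc j) (suc j ^ c) (a ^ j) ⟩
    suc j ^ c * (suc j * (2 ^ j * a ^ j))
  ≡⟨ cong (λ n → suc j ^ c * (suc j * n)) (^-distribʳ-* 2 a j) ⟨
    suc j ^ c * (suc j * (2 * a) ^ j)
  ≤⟨ *-monoʳ-≤ (suc j ^ c) ([1+j]*x^j≤[1+x]^[1+j] (2 * a) j) ⟩
    suc j ^ c * ((1 + 2 * a) * (1 + 2 * a) ^ j)
  ≡⟨ x*[y*z]≡y*[x*z] (suc j ^ c) (1 + 2 * a) ((1 + 2 * a) ^ j) ⟩
    (1 + 2 * a) * (suc j ^ c * (1 + 2 * a) ^ j)
  ≤⟨ *-monoʳ-≤ (1 + 2 * a) (dom j) ⟩
    (1 + 2 * a) * (D * (2 * b) ^ j)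
  ≡⟨ cong (λ n → (1 + 2 * a) * (D * n)) (^-distribʳ-* 2 b j) ⟩
    (1 + 2 * a) * (D * (2 ^ j * b ^ j))
  ≡⟨ pull (1 + 2 * a) D (2 ^ j) (b ^ j) ⟩
    2 ^ j * ((1 + 2 * a) * D * b ^ j) ∎)
  where
  open ≤-Reasoning
  regroup : ∀ t s u v → t * ((s * u) * v) ≡ u * (s * (t * v))
  regroup = solve-∀
  x*[y*z]≡y*[x*z] : ∀ x y z → x * (y * z) ≡ y * (x * z)
  x*[y*z]≡y*[x*z] = solve-∀
  pull : ∀ q d t v → q * (d * (t * v)) ≡ t * ((q * d) * v)
  pull = solve-∀

βCollisions-weighted : ∀ {σ} → 2 ≤ σ → ∀ c → ∃ λ D → ∀ m → m ^ c * βCollisions σ m ≤ D * (σ ^ m * σ ^ m)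
βCollisions-weighted {σ} 2≤σ c with polynomial-≤-exponential c (orderAgreements<σ⁴ σ 2≤σ)
... | D , dom = 2 ^ c * D , λ m →
  subst (λ n → n ^ c * βCollisions σ n ≤ 2 ^ c * D * (σ ^ n * σ ^ n))
        (sym (trans (m≡m%n+[m/n]*n m 2) (+-comm (m % 2) (m / 2 * 2))))
        (bound (m / 2) (m % 2) (<⇒≤ (m%n<n m 2)))
  where
  K = orderAgreements σ
  open ≤-Reasoning
  bound : ∀ j r → r ≤ 2 → (j * 2 + r) ^ c * βCollisions σ (j * 2 + r) ≤ 2 ^ c * D * (σ ^ (j * 2 + r) * σ ^ (j * 2 + r))
  bound j r r≤2 = begin
      (j * 2 + r) ^ c * βCollisions σ (j * 2 + r)
    ≤⟨ *-mono-≤ (^-monoˡ-≤ c (≤-trans (+-monoʳ-≤ (j * 2) r≤2) (≤-reflexive (+-comm (j * 2) 2))))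
                (≤-trans (βCollisions-j*2+r σ j r) (*-monoʳ-≤ (K ^ j) (βCollisions≤ σ r))) ⟩
      (suc j * 2) ^ c * (K ^ j * (σ ^ r * σ ^ r))
    ≡⟨ cong (_* (K ^ j * (σ ^ r * σ ^ r))) (^-distribʳ-* (suc j) 2 c) ⟩
      suc j ^ c * 2 ^ c * (K ^ j * (σ ^ r * σ ^ r))
    ≡⟨ regroup (suc j ^ c) (2 ^ c) (K ^ j) (σ ^ r * σ ^ r) ⟩
      2 ^ c * (suc j ^ c * K ^ j) * (σ ^ r * σ ^ r)
    ≤⟨ *-monoˡ-≤ (σ ^ r * σ ^ r) (*-monoʳ-≤ (2 ^ c) (dom j)) ⟩
      2 ^ c * (D * (σ ^ 4) ^ j) * (σ ^ r * σ ^ r)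
    ≡⟨ regroup′ (2 ^ c) D ((σ ^ 4) ^ j) (σ ^ r * σ ^ r) ⟩
      2 ^ c * D * ((σ ^ 4) ^ j * (σ ^ r * σ ^ r))
    ≡⟨ cong (2 ^ c * D *_) (powers j r) ⟩
      2 ^ c * D * (σ ^ (j * 2 + r) * σ ^ (j * 2 + r)) ∎
    where
    regroup : ∀ p t k s → p * t * (k * s) ≡ t * (p * k) * s
    regroup = solve-∀
    regroup′ : ∀ t d k s → t * (d * k) * s ≡ t * d * (k * s)
    regroup′ = solve-∀
    exponents : ∀ j r → 4 * j + (r + r) ≡ (j * 2 + r) + (j * 2 + r)
    exponents = solve-∀
    powers : ∀ j r → (σ ^ 4) ^ j * (σ ^ r * σ ^ r) ≡ σ ^ (j * 2 + r) * σ ^ (j * 2 + r)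
    powers j r = begin-equality
        (σ ^ 4) ^ j * (σ ^ r * σ ^ r)
      ≡⟨ cong₂ _*_ (^-*-assoc σ 4 j) (sym (^-distribˡ-+-* σ r r)) ⟩
        σ ^ (4 * j) * σ ^ (r + r)
      ≡⟨ ^-distribˡ-+-* σ (4 * j) (r + r) ⟨
        σ ^ (4 * j + (r + r))
      ≡⟨ cong (σ ^_) (exponents j r) ⟩
        σ ^ ((j * 2 + r) + (j * 2 + r))
      ≡⟨ ^-distribˡ-+-* σ (j * 2 + r) (j * 2 + r) ⟩
        σ ^ (j * 2 + r) * σ ^ (j * 2 + r) ∎

totalCost≤ : ∀ {σ} → 2 ≤ σ → ∀ c C₀ → ∃ λ C → ∀ m ls → All (m ≤_) ls → sum ls ≤ C₀ * m ^ c →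
             totalCost σ m ls ≤ C * σ ^ (m + sum ls)
totalCost≤ {σ} 2≤σ c C₀ with βCollisions-weighted 2≤σ c
... | D , weighted = C₀ * D , λ m ls m≤ls M≤C₀m^c →
  *-cancelˡ-≤ (σ ^ m) {{m^n≢0 σ m {{>-nonZero (≤-trans (s≤s z≤n) 2≤σ)}}}} (let M = sum ls ; E = βCollisions σ m in begin
    σ ^ m * totalCost σ m ls
  ≡⟨ totalCost-identity σ m ls m≤ls ⟩
    M * σ ^ M * E
  ≤⟨ *-monoˡ-≤ E (*-monoˡ-≤ (σ ^ M) M≤C₀m^c) ⟩
    C₀ * m ^ c * σ ^ M * E
  ≡⟨ regroup C₀ (m ^ c) (σ ^ M) E ⟩
    σ ^ M * (C₀ * (m ^ c * E))
  ≤⟨ *-monoʳ-≤ (σ ^ M) (*-monoʳ-≤ C₀ (weighted m)) ⟩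
    σ ^ M * (C₀ * (D * (σ ^ m * σ ^ m)))
  ≡⟨ regroup′ (σ ^ M) C₀ D (σ ^ m) ⟩
    σ ^ m * (C₀ * D * (σ ^ m * σ ^ M))
  ≡⟨ cong (λ n → σ ^ m * (C₀ * D * n)) (^-distribˡ-+-* σ m M) ⟨
    σ ^ m * (C₀ * D * σ ^ (m + M)) ∎)
  where
  open ≤-Reasoning
  regroup : ∀ c p s e → c * p * s * e ≡ s * (c * (p * e))
  regroup = solve-∀
  regroup′ : ∀ s c d x → s * (c * (d * (x * x))) ≡ x * (c * d * (x * s))
  regroup′ = solve-∀

minLen≤ : ∀ l₀ ls → All (minLen l₀ ls ≤_) (l₀ ∷ ls)
minLen≤ l₀ []       = ≤-refl ∷ []
minLen≤ l₀ (l ∷ ls) with minLen≤ l₀ ls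
... | m≤l₀ ∷ m≤ls = ≤-trans (m⊓n≤n l _) m≤l₀ ∷ m⊓n≤m l _ ∷ All.map (≤-trans (m⊓n≤n l _)) m≤ls

lemma7 : (σ : ℕ) → 2 ≤ σ → (c C₀ : ℕ) → ∃ λ C → (l₀ : ℕ) → (ls : List ℕ)
         → sum (l₀ ∷ ls) ≤ C₀ * minLen l₀ ls ^ c
         → totalCost σ (minLen l₀ ls) (l₀ ∷ ls) ≤ C * σ ^ (minLen l₀ ls + sum (l₀ ∷ ls))
lemma7 σ 2≤σ c C₀ with totalCost≤ 2≤σ c C₀
... | C , bound = C , λ l₀ ls M≤C₀m^c → bound (minLen l₀ ls) (l₀ ∷ ls) (minLen≤ l₀ ls) M≤C₀m^c
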